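{- Let $k\geq 1$ and let $(C_1,C_2)$ be the type A partition of $\mathbb{Z}_2^{3k}$. Let $t\in\{1,\ldots,3k\}$, $C_3=C_1+e_t$ and $C_4=C_2+e_t$. Then: (1) $C_1\subsetneq C_4$; (2) $C_3\subsetneq C_2$; (3) $C_2\cap C_4\neq\emptyset$.
   Context: The type A partition $(C_1,C_2)$ of $\mathbb{Z}_2^{3k}$ is defined by: $x=(x_1,\ldots,x_{3k})\in C_1$ iff $\bigl(\sum_{i=1}^{k}x_i,\ \sum_{i=k+1}^{2k}x_i,\ \sum_{i=2k+1}^{3k}x_i\bigr)$ (sums mod 2) lies in $\{(0,0,0),(1,1,1)\}$, and $C_2=\mathbb{Z}_2^{3k}\setminus C_1$. Here $e_t\in\mathbb{Z}_2^{3k}$ is the vector with $1$ in coordinate $t$ and $0$ elsewhere, and $X+e_t=\{x+e_t:x\in X\}$ with addition in $\mathbb{Z}_2^{3k}$. The symbol $\subset$ in the paper denotes proper inclusion. -}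

module Defs where

open import Data.Bool using (Bool; true; false; _xor_)
open import Data.Nat using (ℕ; _*_; _≤?_; _<?_)
open import Data.Fin using (Fin; toℕ)
open import Data.List using (List; foldr; filter; map)
open import Data.List.Base using ()
open import Data.Vec using (Vec; lookup; replicate; zipWith; _[_]≔_; allFin)
import Data.Vec as V
open import Data.Product using (Σ; _×_; _,_; ∃)
open import Data.Sum using (_⊎_)
open import Relation.Nullary using (¬_; _×-dec_)
open import Relation.Binary.PropositionalEquality using (_≡_)

-- Elements of Z_2^n are Vec Bool n (false = 0, true = 1); addition is xor.
-- Coordinate i (1-based, paper) is index i-1 (0-based Fin).

_⊕_ : {n : ℕ} → Vec Bool n → Vec Bool n → Vec Bool n
_⊕_ = zipWith _xor_

e : {n : ℕ} → Fin n → Vec Bool n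
e t = replicate _ false [ t ]≔ true

blockSum : {n : ℕ} → Vec Bool n → ℕ → ℕ → Bool
blockSum {n} x lo hi =
  foldr _xor_ false
    (map (lookup x)
      (filter (λ i → (lo ≤? toℕ i) ×-dec (toℕ i <? hi)) (V.toList (allFin n))))

Subset : ℕ → Set₁
Subset n = Vec Bool n → Set

_⊆_ : {n : ℕ} → Subset n → Subset n → Set
A ⊆ B = ∀ x → A x → B x

_⊊_ : {n : ℕ} → Subset n → Subset n → Set
A ⊊ B = A ⊆ B × Σ _ (λ x → B x × ¬ A x)

_∩_ : {n : ℕ} → Subset n → Subset n → Subset n
(A ∩ B) x = A x × B x

Nonempty : {n : ℕ} → Subset n → Set
Nonempty A = Σ _ A

_+ₛ_ : {n : ℕ} → Subset n → Vec Bool n → Subset n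
(X +ₛ v) x = Σ _ (λ y → X y × x ≡ y ⊕ v)

C₁ : (k : ℕ) → Subset (3 * k)
C₁ k x = (blockSum x 0 k ≡ false × blockSum x k (2 * k) ≡ false × blockSum x (2 * k) (3 * k) ≡ false)
       ⊎ (blockSum x 0 k ≡ true × blockSum x k (2 * k) ≡ true × blockSum x (2 * k) (3 * k) ≡ true)

C₂ : (k : ℕ) → Subset (3 * k)
C₂ k x = ¬ C₁ k x

module Submission where

-- The three block parities form a homomorphism σ : ℤ₂^{3k} → ℤ₂³, and C₁ = σ⁻¹{000, 111} is the
-- preimage of a subgroup, hence itself a subgroup. Since σ(e_t) is a unit vector, e_t ∉ C₁, so the
-- coset C₁ + e_t is disjoint from C₁, i.e. C₁ + e_t ⊆ C₂ (equivalently C₁ ⊆ C₂ + e_t). Taking s in a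
-- block other than that of t, both σ(e_s) and σ(e_s + e_t) are neither 000 nor 111, so e_s lies in
-- C₂ ∩ (C₂ + e_t); it witnesses both strict inclusions and the non-emptiness.

open import Defs
open import Algebra.Bundles using (CommutativeRing)
open import Data.Bool using (Bool; true; false; _xor_)
open import Data.Bool.Properties using (xor-∧-commutativeRing; not-involutive; xor-same; xor-inverseˡ)
open import Algebra.Properties.CommutativeSemigroup (CommutativeRing.+-commutativeSemigroup xor-∧-commutativeRing) using (interchange)
open import Data.Empty using (⊥-elim)
open import Data.Fin using (Fin; toℕ; fromℕ<; zero; suc)
open import Data.Fin.Properties using (toℕ-fromℕ<; toℕ<n)
open import Data.List as List using (List; []; _∷_; foldr; filter; map)
open import Data.List.Membership.Propositional using (_∈_; _∉_)
open import Data.List.Membership.Propositional.Properties using (∈-filter⁺; ∈-filter⁻; ∈-allFin)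
open import Data.List.Relation.Unary.All.Properties using (All¬⇒¬Any)
open import Data.List.Relation.Unary.AllPairs using (_∷_)
open import Data.List.Relation.Unary.Any using (here; there)
open import Data.List.Relation.Unary.Unique.Propositional using (Unique)
open import Data.List.Relation.Unary.Unique.Propositional.Properties using (filter⁺; allFin⁺)
open import Data.Nat using (ℕ; _*_; _≤_; _<_; _≥_; _≤?_; _<?_; z≤n; NonZero; >-nonZero; >-nonZero⁻¹)
open import Data.Nat.Properties using (≤-trans; <-≤-trans; ≤-<-trans; <⇒≱; ≮⇒≥; ≤-refl; m≤n*m; *-monoˡ-<)
open import Data.Product using (_×_; _,_; proj₁; proj₂; ∃-syntax)
open import Data.Sum using (_⊎_; inj₁; inj₂)
open import Data.Vec as Vec using (Vec; []; _∷_; lookup; replicate)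
open import Data.Vec.Properties using (lookup-zipWith; lookup∘update; lookup∘update′; lookup-replicate)
open import Relation.Nullary using (¬_; _×-dec_; yes; no)
open import Relation.Binary.PropositionalEquality using (_≡_; _≢_; refl; sym; trans; cong; cong₂; subst; module ≡-Reasoning)

xor-cancelˡ : ∀ a b → a xor (a xor b) ≡ b
xor-cancelˡ false b = refl
xor-cancelˡ true  b = not-involutive b

xor-cancelʳ : ∀ a b → (a xor b) xor b ≡ a
xor-cancelʳ false b = xor-same b
xor-cancelʳ true  b = xor-inverseˡ b

⊕-cancelˡ : ∀ {n} (x v : Vec Bool n) → x ⊕ (x ⊕ v) ≡ v
⊕-cancelˡ []      []      = refl
⊕-cancelˡ (a ∷ x) (b ∷ v) = cong₂ _∷_ (xor-cancelˡ a b) (⊕-cancelˡ x v)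

⊕-cancelʳ : ∀ {n} (x v : Vec Bool n) → (x ⊕ v) ⊕ v ≡ x
⊕-cancelʳ []      []      = refl
⊕-cancelʳ (a ∷ x) (b ∷ v) = cong₂ _∷_ (xor-cancelʳ a b) (⊕-cancelʳ x v)

module _ {n : ℕ} {X : Subset n} {v : Vec Bool n} where

  +ₛ⁺ : ∀ {x} → X (x ⊕ v) → (X +ₛ v) x
  +ₛ⁺ {x} Xx⊕v = x ⊕ v , Xx⊕v , sym (⊕-cancelʳ x v)

  +ₛ⁻ : ∀ {x} → (X +ₛ v) x → X (x ⊕ v)
  +ₛ⁻ (y , Xy , refl) = subst X (sym (⊕-cancelʳ y v)) Xy

lookup-e-self : ∀ {n} (t : Fin n) → lookup (e t) t ≡ true
lookup-e-self {n} t = lookup∘update t (replicate n false) true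

lookup-e-other : ∀ {n} {t i : Fin n} → i ≢ t → lookup (e t) i ≡ false
lookup-e-other {n} {t} {i} i≢t =
  trans (lookup∘update′ i≢t (replicate n false) true) (lookup-replicate i false)

parity : ∀ {n} → List (Fin n) → Vec Bool n → Bool
parity is x = foldr _xor_ false (map (lookup x) is)

parity-⊕ : ∀ {n} (is : List (Fin n)) (x y : Vec Bool n) →
  parity is (x ⊕ y) ≡ parity is x xor parity is y
parity-⊕ []       x y = refl
parity-⊕ (i ∷ is) x y = begin
  lookup (x ⊕ y) i xor parity is (x ⊕ y)
    ≡⟨ cong₂ _xor_ (lookup-zipWith _xor_ i x y) (parity-⊕ is x y) ⟩
  (lookup x i xor lookup y i) xor (parity is x xor parity is y)
    ≡⟨ interchange (lookup x i) (lookup y i) (parity is x) (parity is y) ⟩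
  parity (i ∷ is) x xor parity (i ∷ is) y
    ∎
  where open ≡-Reasoning

parity-e-∉ : ∀ {n} {t : Fin n} (is : List (Fin n)) → t ∉ is → parity is (e t) ≡ false
parity-e-∉ []       _   = refl
parity-e-∉ (i ∷ is) t∉ =
  cong₂ _xor_ (lookup-e-other λ i≡t → t∉ (here (sym i≡t))) (parity-e-∉ is (λ t∈ → t∉ (there t∈)))

parity-e-∈ : ∀ {n} {t : Fin n} {is : List (Fin n)} → Unique is → t ∈ is → parity is (e t) ≡ true
parity-e-∈ {t = t} {i ∷ is} (i∉is ∷ _) (here refl) =
  cong₂ _xor_ (lookup-e-self t) (parity-e-∉ is (All¬⇒¬Any i∉is))
parity-e-∈ {t = t} {i ∷ is} (i∉is ∷ unique) (there t∈is) =
  cong₂ _xor_ (lookup-e-other {t = t} λ { refl → All¬⇒¬Any i∉is t∈is }) (parity-e-∈ unique t∈is)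

toList-tabulate : ∀ {n} {A : Set} (f : Fin n → A) → Vec.toList (Vec.tabulate f) ≡ List.tabulate f
toList-tabulate {ℕ.zero}  f = refl
toList-tabulate {ℕ.suc n} f = cong (f zero ∷_) (toList-tabulate (λ i → f (suc i)))

toList-allFin : ∀ n → Vec.toList (Vec.allFin n) ≡ List.allFin n
toList-allFin n = toList-tabulate (λ i → i)

module _ {n : ℕ} (lo hi : ℕ) where

  window : List (Fin n)
  window = filter (λ i → (lo ≤? toℕ i) ×-dec (toℕ i <? hi)) (Vec.toList (Vec.allFin n))

  window-unique : Unique window
  window-unique = filter⁺ _ (subst Unique (sym (toList-allFin n)) (allFin⁺ n))

  ∈-window : {t : Fin n} → lo ≤ toℕ t → toℕ t < hi → t ∈ window
  ∈-window {t} lo≤t t<hi =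
    ∈-filter⁺ _ (subst (t ∈_) (sym (toList-allFin n)) (∈-allFin t)) (lo≤t , t<hi)

  ∈-window⁻ : {t : Fin n} → t ∈ window → lo ≤ toℕ t × toℕ t < hi
  ∈-window⁻ t∈ = proj₂ (∈-filter⁻ _ {xs = Vec.toList (Vec.allFin n)} t∈)

module _ {n : ℕ} {lo hi : ℕ} where

  blockSum-⊕ : (x y : Vec Bool n) → blockSum (x ⊕ y) lo hi ≡ blockSum x lo hi xor blockSum y lo hi
  blockSum-⊕ = parity-⊕ (window lo hi)

  blockSum-e-inside : {t : Fin n} → lo ≤ toℕ t → toℕ t < hi → blockSum (e t) lo hi ≡ true
  blockSum-e-inside lo≤t t<hi = parity-e-∈ (window-unique lo hi) (∈-window lo hi lo≤t t<hi)

  blockSum-e-below : {t : Fin n} → toℕ t < lo → blockSum (e t) lo hi ≡ false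
  blockSum-e-below t<lo = parity-e-∉ (window lo hi) λ t∈ → <⇒≱ t<lo (proj₁ (∈-window⁻ lo hi t∈))

  blockSum-e-above : {t : Fin n} → hi ≤ toℕ t → blockSum (e t) lo hi ≡ false
  blockSum-e-above hi≤t = parity-e-∉ (window lo hi) λ t∈ → <⇒≱ (proj₂ (∈-window⁻ lo hi t∈)) hi≤t

Bool³ : Set
Bool³ = Bool × Bool × Bool

_⊕³_ : Bool³ → Bool³ → Bool³
(a , b , c) ⊕³ (a′ , b′ , c′) = a xor a′ , b xor b′ , c xor c′

Balanced : Bool³ → Set
Balanced (a , b , c) = (a ≡ false × b ≡ false × c ≡ false) ⊎ (a ≡ true × b ≡ true × c ≡ true)

Balanced-⊕³ : ∀ {u v} → Balanced u → Balanced v → Balanced (u ⊕³ v)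
Balanced-⊕³ (inj₁ (refl , refl , refl)) (inj₁ (refl , refl , refl)) = inj₁ (refl , refl , refl)
Balanced-⊕³ (inj₁ (refl , refl , refl)) (inj₂ (refl , refl , refl)) = inj₂ (refl , refl , refl)
Balanced-⊕³ (inj₂ (refl , refl , refl)) (inj₁ (refl , refl , refl)) = inj₂ (refl , refl , refl)
Balanced-⊕³ (inj₂ (refl , refl , refl)) (inj₂ (refl , refl , refl)) = inj₁ (refl , refl , refl)

unbalancedˡ : ∀ {a b c} → a ≢ b → ¬ Balanced (a , b , c)
unbalancedˡ a≢b (inj₁ (refl , refl , _)) = a≢b refl
unbalancedˡ a≢b (inj₂ (refl , refl , _)) = a≢b refl

unbalancedʳ : ∀ {a b c} → b ≢ c → ¬ Balanced (a , b , c)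
unbalancedʳ b≢c (inj₁ (_ , refl , refl)) = b≢c refl
unbalancedʳ b≢c (inj₂ (_ , refl , refl)) = b≢c refl

unit : Fin 3 → Bool³
unit zero             = true  , false , false
unit (suc zero)       = false , true  , false
unit (suc (suc zero)) = false , false , true

unit-unbalanced : ∀ i → ¬ Balanced (unit i)
unit-unbalanced zero             = unbalancedˡ λ ()
unit-unbalanced (suc zero)       = unbalancedˡ λ ()
unit-unbalanced (suc (suc zero)) = unbalancedʳ λ ()

unit-⊕³-unit-unbalanced : ∀ {i j} → i ≢ j → ¬ Balanced (unit i ⊕³ unit j)
unit-⊕³-unit-unbalanced {zero}             {zero}             i≢j = ⊥-elim (i≢j refl)
unit-⊕³-unit-unbalanced {zero}             {suc zero}         _   = unbalancedʳ λ ()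
unit-⊕³-unit-unbalanced {zero}             {suc (suc zero)}   _   = unbalancedˡ λ ()
unit-⊕³-unit-unbalanced {suc zero}         {zero}             _   = unbalancedʳ λ ()
unit-⊕³-unit-unbalanced {suc zero}         {suc zero}         i≢j = ⊥-elim (i≢j refl)
unit-⊕³-unit-unbalanced {suc zero}         {suc (suc zero)}   _   = unbalancedˡ λ ()
unit-⊕³-unit-unbalanced {suc (suc zero)}   {zero}             _   = unbalancedˡ λ ()
unit-⊕³-unit-unbalanced {suc (suc zero)}   {suc zero}         _   = unbalancedˡ λ ()
unit-⊕³-unit-unbalanced {suc (suc zero)}   {suc (suc zero)}   i≢j = ⊥-elim (i≢j refl)

-- C₁ k x unfolds to Balanced (signature k x).
signature : (k : ℕ) → Vec Bool (3 * k) → Bool³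
signature k x = blockSum x 0 k , blockSum x k (2 * k) , blockSum x (2 * k) (3 * k)

module _ (k : ℕ) where

  signature-⊕ : (x y : Vec Bool (3 * k)) → signature k (x ⊕ y) ≡ signature k x ⊕³ signature k y
  signature-⊕ x y = cong₂ _,_ (blockSum-⊕ x y) (cong₂ _,_ (blockSum-⊕ x y) (blockSum-⊕ x y))

  k≤2k : k ≤ 2 * k
  k≤2k = m≤n*m k 2

  signature-e-first : {t : Fin (3 * k)} → toℕ t < k → signature k (e t) ≡ unit zero
  signature-e-first t<k = cong₂ _,_ (blockSum-e-inside z≤n t<k)
    (cong₂ _,_ (blockSum-e-below t<k) (blockSum-e-below (<-≤-trans t<k k≤2k)))

  signature-e-second : {t : Fin (3 * k)} → k ≤ toℕ t → toℕ t < 2 * k → signature k (e t) ≡ unit (suc zero)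
  signature-e-second k≤t t<2k = cong₂ _,_ (blockSum-e-above k≤t)
    (cong₂ _,_ (blockSum-e-inside k≤t t<2k) (blockSum-e-below t<2k))

  signature-e-third : {t : Fin (3 * k)} → 2 * k ≤ toℕ t → signature k (e t) ≡ unit (suc (suc zero))
  signature-e-third {t} 2k≤t = cong₂ _,_ (blockSum-e-above (≤-trans k≤2k 2k≤t))
    (cong₂ _,_ (blockSum-e-above 2k≤t) (blockSum-e-inside 2k≤t (toℕ<n t)))

  signature-e : (t : Fin (3 * k)) → ∃[ i ] signature k (e t) ≡ unit i
  signature-e t with toℕ t <? k | toℕ t <? 2 * k
  ... | yes t<k | _        = zero , signature-e-first t<k
  ... | no t≮k  | yes t<2k = suc zero , signature-e-second (≮⇒≥ t≮k) t<2k
  ... | no _    | no t≮2k  = suc (suc zero) , signature-e-third (≮⇒≥ t≮2k)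

  C₁-⊕ : (x y : Vec Bool (3 * k)) → C₁ k x → C₁ k y → C₁ k (x ⊕ y)
  C₁-⊕ x y x∈C₁ y∈C₁ = subst Balanced (sym (signature-⊕ x y)) (Balanced-⊕³ x∈C₁ y∈C₁)

  e∈C₂ : (t : Fin (3 * k)) → C₂ k (e t)
  e∈C₂ t with signature-e t
  ... | i , σe≡unit = λ e∈C₁ → unit-unbalanced i (subst Balanced σe≡unit e∈C₁)

  C₁⇒⊕e∈C₂ : (x : Vec Bool (3 * k)) (t : Fin (3 * k)) → C₁ k x → C₂ k (x ⊕ e t)
  C₁⇒⊕e∈C₂ x t x∈C₁ x⊕e∈C₁ = e∈C₂ t (subst (C₁ k) (⊕-cancelˡ x (e t)) (C₁-⊕ x (x ⊕ e t) x∈C₁ x⊕e∈C₁))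

  e⊕e∈C₂ : ∀ {s t} i j → i ≢ j → signature k (e s) ≡ unit i → signature k (e t) ≡ unit j →
    C₂ k (e s ⊕ e t)
  e⊕e∈C₂ {s} {t} _ _ i≢j σs σt e⊕e∈C₁ =
    unit-⊕³-unit-unbalanced i≢j (subst Balanced (trans (signature-⊕ (e s) (e t)) (cong₂ _⊕³_ σs σt)) e⊕e∈C₁)

  module _ .{{_ : NonZero k}} where

    2k<3k : 2 * k < 3 * k
    2k<3k = *-monoˡ-< k {2} {3} ≤-refl

    firstIndex lastIndex : Fin (3 * k)
    firstIndex = fromℕ< (≤-<-trans z≤n 2k<3k)
    lastIndex  = fromℕ< 2k<3k

    signature-e-firstIndex : signature k (e firstIndex) ≡ unit zero
    signature-e-firstIndex =
      signature-e-first (subst (_< k) (sym (toℕ-fromℕ< _)) (>-nonZero⁻¹ k))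

    signature-e-lastIndex : signature k (e lastIndex) ≡ unit (suc (suc zero))
    signature-e-lastIndex = signature-e-third (subst (2 * k ≤_) (sym (toℕ-fromℕ< _)) ≤-refl)

    C₂-shift-witness : (t : Fin (3 * k)) → ∃[ w ] C₂ k w × C₂ k (w ⊕ e t)
    C₂-shift-witness t with signature-e t
    ... | zero  , σt = e lastIndex , e∈C₂ lastIndex ,
                       e⊕e∈C₂ (suc (suc zero)) zero (λ ()) signature-e-lastIndex σt
    ... | suc j , σt = e firstIndex , e∈C₂ firstIndex ,
                       e⊕e∈C₂ zero (suc j) (λ ()) signature-e-firstIndex σt

lemma5 : (k : ℕ) → k ≥ 1 → (t : Fin (3 * k)) →
    (C₁ k ⊊ (C₂ k +ₛ e t)) × ((C₁ k +ₛ e t) ⊊ C₂ k) × Nonempty (C₂ k ∩ (C₂ k +ₛ e t))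
lemma5 k k≥1 t with C₂-shift-witness k {{>-nonZero k≥1}} t
... | w , w∈C₂ , w⊕e∈C₂ =
  ((λ x x∈C₁ → +ₛ⁺ (C₁⇒⊕e∈C₂ k x t x∈C₁)) , w , +ₛ⁺ w⊕e∈C₂ , w∈C₂) ,
  ((λ { x (y , y∈C₁ , refl) → C₁⇒⊕e∈C₂ k y t y∈C₁ }) , w , w∈C₂ , λ w∈C₁+e → w⊕e∈C₂ (+ₛ⁻ w∈C₁+e)) ,
  (w , w∈C₂ , +ₛ⁺ w⊕e∈C₂)
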